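{- Let $F=(V;E,A)$ be a mixed graph, $k$ a positive integer, and $f,g:V\to\mathbb{N}$ functions with $f\le g$, such that for every family $\mathcal{P}=\{X_1,\ldots,X_t\}$ of pairwise disjoint subsets of $V$ both $$e_E(\mathcal{P})+\sum_{j=1}^t d_A^-(X_j)\ge k(t-1)+\widetilde{f}\Big(V\setminus\bigcup_{j=1}^tX_j\Big)\quad\text{and}\quad e_E(\mathcal{P})+\sum_{j=1}^t d_A^-(X_j)\ge kt-\widetilde{g}\Big(\bigcup_{j=1}^tX_j\Big)$$ hold. Let $\mathcal{D}(V)$ be the set of all families of pairwise disjoint subsets of $V$, and define $$\mathcal{E}^1=\Big\{\mathcal{F}\in\mathcal{D}(V): e_E(\mathcal{F})+\sum_{X\in\mathcal{F}}d_A^-(X)=k(|\mathcal{F}|-1)+\widetilde{f}\big(V\setminus\textstyle\bigcup\mathcal{F}\big)\Big\},$$ $$\mathcal{E}^2=\Big\{\mathcal{F}\in\mathcal{D}(V): e_E(\mathcal{F})+\sum_{X\in\mathcal{F}}d_A^-(X)=k|\mathcal{F}|-\widetilde{g}\big(\textstyle\bigcup\mathcal{F}\big)\Big\}.$$ Then for any $\mathcal{F}_1,\mathcal{F}_2\in\mathcal{E}^1\cup\mathcal{E}^2$, there is no edge $e\in E$ having one end in $\bigcup\mathcal{F}_1\setminus\bigcup\mathcal{F}_2$ and the other end in $\bigcup\mathcal{F}_2\setminus\bigcup\mathcal{F}_1$.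
   Context: A mixed graph $F=(V;E,A)$ has vertex set $V$, a set $E$ of undirected edges and a set $A$ of directed arcs (multiple edges/arcs allowed, no loops). For a family $\mathcal{P}$ of pairwise disjoint subsets of $V$, $\bigcup\mathcal{P}$ is the union of its members, and $e_E(\mathcal{P})$ is the number of edges $e\in E$ with one end in some member $X$ of $\mathcal{P}$ and the other end either in a different member of $\mathcal{P}$ or in $V\setminus\bigcup\mathcal{P}$. For $X\subseteq V$, $d_A^-(X)$ is the number of arcs of $A$ with tail outside $X$ and head in $X$. For $h:V\to\mathbb{N}$ and $X\subseteq V$, $\widetilde{h}(X)=\sum_{x\in X}h(x)$. -}

module Defs where

open import Data.Bool using (Bool; true; false; if_then_else_; _∧_; _∨_; not)
open import Data.Nat using (ℕ; zero; suc)
open import Data.Fin using (Fin)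
open import Data.Fin.Subset public using (Subset; _∈_; ∁; ⋃; Nonempty; _∩_)
open import Data.Vec using (lookup)
open import Data.List using (List; []; _∷_; length; allFin; map)
open import Data.Nat.ListAction using (sum)
open import Data.Bool.ListAction using (any)
open import Data.List.Relation.Unary.AllPairs public using (AllPairs)
open import Data.List.Relation.Unary.All public using (All)
open import Data.Product using (_×_; _,_; proj₁; proj₂)
open import Data.Empty using (⊥)
open import Data.Integer as ℤ using (ℤ; +_)
open import Relation.Binary.PropositionalEquality using (_≡_; _≢_)

-- Vertex set V = Fin n.  A mixed graph: a list of undirected edges and a list
-- of directed arcs (tail , head); multiplicities allowed, loops excluded.
record MixedGraph (n : ℕ) : Set where
  field
    E : List (Fin n × Fin n)
    A : List (Fin n × Fin n)
    E-noLoop : All (λ e → proj₁ e ≢ proj₂ e) E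
    A-noLoop : All (λ a → proj₁ a ≢ proj₂ a) A
open MixedGraph public

_∈ᵇ_ : ∀ {n} → Fin n → Subset n → Bool
x ∈ᵇ X = lookup X x

count : ∀ {a} {T : Set a} → (T → Bool) → List T → ℕ
count p [] = 0
count p (x ∷ xs) = if p x then suc (count p xs) else count p xs

Disjoint : ∀ {n} → Subset n → Subset n → Set
Disjoint X Y = ∀ x → x ∈ X → x ∈ Y → ⊥

IsFamily : ∀ {n} → List (Subset n) → Set
IsFamily P = AllPairs Disjoint P × All Nonempty P

-- e_E(P): edges with one end in some member X and the other end outside X
-- (i.e. in a different member or outside ⋃P)
crosses : ∀ {n} → List (Subset n) → Fin n × Fin n → Bool
crosses P (u , v) =
  any (λ X → ((u ∈ᵇ X) ∧ not (v ∈ᵇ X)) ∨ ((v ∈ᵇ X) ∧ not (u ∈ᵇ X))) P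

eE : ∀ {n} → MixedGraph n → List (Subset n) → ℕ
eE F P = count (crosses P) (E F)

dA⁻ : ∀ {n} → MixedGraph n → Subset n → ℕ
dA⁻ F X = count (λ a → not (proj₁ a ∈ᵇ X) ∧ (proj₂ a ∈ᵇ X)) (A F)

tilde : ∀ {n} → (Fin n → ℕ) → Subset n → ℕ
tilde {n} h X = sum (map (λ x → if x ∈ᵇ X then h x else 0) (allFin n))

lhs : ∀ {n} → MixedGraph n → List (Subset n) → ℕ
lhs F P = eE F P Data.Nat.+ sum (map (dA⁻ F) P)

rhs1 : ∀ {n} → ℕ → (Fin n → ℕ) → List (Subset n) → ℤ
rhs1 k f P = (+ k) ℤ.* ((+ length P) ℤ.- (+ 1)) ℤ.+ (+ tilde f (∁ (⋃ P)))

rhs2 : ∀ {n} → ℕ → (Fin n → ℕ) → List (Subset n) → ℤ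
rhs2 k g P = (+ k) ℤ.* (+ length P) ℤ.- (+ tilde g (⋃ P))

InE1 : ∀ {n} → MixedGraph n → ℕ → (Fin n → ℕ) → List (Subset n) → Set
InE1 F k f P = IsFamily P × (+ lhs F P ≡ rhs1 k f P)

InE2 : ∀ {n} → MixedGraph n → ℕ → (Fin n → ℕ) → List (Subset n) → Set
InE2 F k g P = IsFamily P × (+ lhs F P ≡ rhs2 k g P)

module Submission where

-- Proof by uncrossing.  From F₁ and F₂ we build a family P of "unions" (the
-- blocks of F₁ and F₂ that overlap are merged, so ⋃P = ⋃F₁ ∪ ⋃F₂) and a family Q
-- of "intersections" (⋃Q = ⋃F₁ ∩ ⋃F₂) with |P| + |Q| = |F₁| + |F₂|.  Comparing
-- edge by edge and arc by arc, e_E + Σ d_A⁻ is no larger on P, Q than on F₁, F₂,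
-- and strictly smaller if some edge joins ⋃F₁ ∖ ⋃F₂ to ⋃F₂ ∖ ⋃F₁: such an edge
-- crosses F₁ and F₂ but not Q.  On the other side, the vertex weights f̃(V ∖ ⋃·)
-- and g̃(⋃·) behave modularly under ∪ and ∩, so the bounds attained by the tight
-- families F₁, F₂ are dominated by bounds that the hypothesis guarantees for P, Q.
-- Together this gives lhs F₁ + lhs F₂ < lhs F₁ + lhs F₂.

open import Defs
open import Data.Nat using (ℕ; _≤_)
open import Data.Fin using (Fin)
open import Data.Integer as ℤ using (+_)
open import Data.List using (List)
open import Data.List.Membership.Propositional using () renaming (_∈_ to _∈ₗ_)
open import Data.Product using (_×_; _,_; Σ)
open import Data.Sum using (_⊎_)
open import Relation.Nullary using (¬_)
open import Relation.Binary.PropositionalEquality using (_≡_)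

open import Data.Bool using (Bool; true; false; if_then_else_; _∧_; _∨_; not)
open import Data.Bool.ListAction using (any)
open import Data.Empty using (⊥; ⊥-elim)
open import Data.Fin.Subset using (_∉_; _⊆_; _∪_)
open import Data.Fin.Subset.Properties
  using (_∈?_; ∉⊥; x∈p∪q⁺; x∈p∪q⁻; x∈p∩q⁺; x∈p∩q⁻; ⊆-antisym; nonempty?; ∪-comm; ∩-comm)
open import Data.Integer.Tactic.RingSolver using (solve-∀)
open import Data.List using ([]; _∷_; _++_; map; length; filter; allFin)
open import Data.List.Membership.Propositional using (find; lose)
open import Data.List.Membership.Propositional.Properties
  using (∈-++⁻; ∈-++⁺ˡ; ∈-++⁺ʳ; ∈-filter⁺; ∈-filter⁻; ∈-map⁺)
open import Data.List.Relation.Unary.Any using (here; there)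
open import Data.Nat using (zero; suc; _+_; _*_; _<_; z≤n; s≤s)
open import Data.Nat.ListAction using (sum)
open import Data.Product using (proj₁; proj₂)
open import Data.Sum using (inj₁; inj₂; [_,_])
open import Data.Vec using (lookup)
open import Function using (_∘_; id; Equivalence)
open import Relation.Binary.PropositionalEquality
  using (refl; sym; trans; cong; cong₂; subst; subst₂; module ≡-Reasoning)
open import Relation.Nullary using (yes; no)
open import Relation.Unary using (Pred; Decidable)
open import Relation.Unary.Properties using (∁?)
import Data.Bool.Properties as BoolP
import Data.Integer.Properties as ℤP
import Data.List.Properties as ListP
import Data.List.Relation.Unary.All as All
import Data.List.Relation.Unary.All.Properties as AllP
import Data.List.Relation.Unary.AllPairs as AllPairs
import Data.List.Relation.Unary.AllPairs.Properties as AllPairsP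
import Data.List.Relation.Unary.Any.Properties as AnyP
import Data.Nat.Properties as ℕP
import Data.Vec.Properties as VecP
open import Algebra.Properties.CommutativeSemigroup ℕP.+-commutativeSemigroup
  using () renaming (interchange to +-interchange)
open import Algebra.Properties.CommutativeSemigroup ℤP.+-commutativeSemigroup
  using () renaming (interchange to +-interchangeℤ)

ind : Bool → ℕ
ind b = if b then 1 else 0

ind≤1 : ∀ b → ind b ≤ 1
ind≤1 true = s≤s z≤n
ind≤1 false = z≤n

ind-pos⁻ : ∀ {b} → 1 ≤ ind b → b ≡ true
ind-pos⁻ {true} _ = refl

ind-pos⁺ : ∀ {b} → b ≡ true → 1 ≤ ind b
ind-pos⁺ refl = s≤s z≤n

total : ∀ {a} {T : Set a} → (T → ℕ) → List T → ℕ
total w xs = sum (map w xs)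

module _ {a} {T : Set a} where

  count≡total : ∀ (p : T → Bool) xs → count p xs ≡ total (ind ∘ p) xs
  count≡total p [] = refl
  count≡total p (x ∷ xs) with p x
  ... | true = cong suc (count≡total p xs)
  ... | false = count≡total p xs

  total-cong : ∀ {f g : T → ℕ} xs → (∀ x → f x ≡ g x) → total f xs ≡ total g xs
  total-cong xs f≗g = cong sum (ListP.map-cong f≗g xs)

  total-+ : ∀ (f g : T → ℕ) xs → total (λ x → f x + g x) xs ≡ total f xs + total g xs
  total-+ f g [] = refl
  total-+ f g (x ∷ xs) = begin
    f x + g x + total (λ y → f y + g y) xs  ≡⟨ cong (_+_ (f x + g x)) (total-+ f g xs) ⟩
    f x + g x + (total f xs + total g xs)  ≡⟨ +-interchange (f x) (g x) (total f xs) (total g xs) ⟩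
    f x + total f xs + (g x + total g xs)  ∎
    where open ≡-Reasoning

  total-mono : ∀ {f g : T → ℕ} xs → (∀ {x} → x ∈ₗ xs → f x ≤ g x) → total f xs ≤ total g xs
  total-mono [] f≤g = z≤n
  total-mono (x ∷ xs) f≤g = ℕP.+-mono-≤ (f≤g (here refl)) (total-mono xs (f≤g ∘ there))

  total-mono-< : ∀ {f g : T → ℕ} {x₀} xs → (∀ {x} → x ∈ₗ xs → f x ≤ g x) →
    x₀ ∈ₗ xs → f x₀ < g x₀ → total f xs < total g xs
  total-mono-< (x ∷ xs) f≤g (here refl) fx<gx =
    ℕP.+-mono-<-≤ fx<gx (total-mono xs (f≤g ∘ there))
  total-mono-< (x ∷ xs) f≤g (there x₀∈xs) fx<gx =
    ℕP.+-mono-≤-< (f≤g (here refl)) (total-mono-< xs (f≤g ∘ there) x₀∈xs fx<gx)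

  total₂-mono : ∀ {f₁ f₂ g₁ g₂ : T → ℕ} xs →
    (∀ {x} → x ∈ₗ xs → f₁ x + f₂ x ≤ g₁ x + g₂ x) →
    total f₁ xs + total f₂ xs ≤ total g₁ xs + total g₂ xs
  total₂-mono {f₁} {f₂} {g₁} {g₂} xs h =
    subst₂ _≤_ (total-+ f₁ f₂ xs) (total-+ g₁ g₂ xs) (total-mono xs h)

  total₂-mono-< : ∀ {f₁ f₂ g₁ g₂ : T → ℕ} {x₀} xs →
    (∀ {x} → x ∈ₗ xs → f₁ x + f₂ x ≤ g₁ x + g₂ x) →
    x₀ ∈ₗ xs → f₁ x₀ + f₂ x₀ < g₁ x₀ + g₂ x₀ →
    total f₁ xs + total f₂ xs < total g₁ xs + total g₂ xs
  total₂-mono-< {f₁} {f₂} {g₁} {g₂} xs h x₀∈xs lt =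
    subst₂ _<_ (total-+ f₁ f₂ xs) (total-+ g₁ g₂ xs) (total-mono-< xs h x₀∈xs lt)

total-swap : ∀ {a b} {S : Set a} {T : Set b} (w : S → T → ℕ) xs ys →
  total (λ x → total (w x) ys) xs ≡ total (λ y → total (λ x → w x y) xs) ys
total-swap w [] ys = sym (total-zero ys)
  where
  total-zero : ∀ ys → total (λ _ → 0) ys ≡ 0
  total-zero [] = refl
  total-zero (_ ∷ ys) = total-zero ys
total-swap w (x ∷ xs) ys = begin
  total (w x) ys + total (λ x′ → total (w x′) ys) xs
    ≡⟨ cong (_+_ (total (w x) ys)) (total-swap w xs ys) ⟩
  total (w x) ys + total (λ y → total (λ x′ → w x′ y) xs) ys
    ≡⟨ total-+ (w x) _ ys ⟨
  total (λ y → w x y + total (λ x′ → w x′ y) xs) ys ∎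
  where open ≡-Reasoning

module _ {a} {T : Set a} (p : T → Bool) where

  total-ind-pos⁻ : ∀ xs → 1 ≤ total (ind ∘ p) xs → Σ T λ x → x ∈ₗ xs × p x ≡ true
  total-ind-pos⁻ (x ∷ xs) pos with p x in px
  ... | true = x , here refl , px
  ... | false = let (y , y∈xs , py) = total-ind-pos⁻ xs pos in y , there y∈xs , py

  total-ind-pos⁺ : ∀ {x} xs → x ∈ₗ xs → p x ≡ true → 1 ≤ total (ind ∘ p) xs
  total-ind-pos⁺ (x ∷ xs) (here refl) px rewrite px = s≤s z≤n
  total-ind-pos⁺ (y ∷ xs) (there x∈xs) px =
    ℕP.≤-trans (total-ind-pos⁺ xs x∈xs px) (ℕP.m≤n+m _ (ind (p y)))

  total-ind-zero : ∀ {xs} → All (λ x → p x ≡ true → ⊥) xs → total (ind ∘ p) xs ≡ 0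
  total-ind-zero All.[] = refl
  total-ind-zero {x ∷ xs} (¬px All.∷ rest) with p x
  ... | true = ⊥-elim (¬px refl)
  ... | false = total-ind-zero rest

  total-ind-≤1 : ∀ {xs} → AllPairs (λ x y → p x ≡ true → p y ≡ true → ⊥) xs →
    total (ind ∘ p) xs ≤ 1
  total-ind-≤1 AllPairs.[] = z≤n
  total-ind-≤1 {x ∷ xs} (excl AllPairs.∷ rest) with p x
  ... | true rewrite total-ind-zero (All.map (λ ex → ex refl) excl) = s≤s z≤n
  ... | false = total-ind-≤1 rest

any≡true⁻ : ∀ {a} {T : Set a} (p : T → Bool) xs → any p xs ≡ true →
  Σ T λ x → x ∈ₗ xs × p x ≡ true
any≡true⁻ p xs h =
  let (x , x∈xs , px) = find (AnyP.any⁻ p xs (Equivalence.from BoolP.T-≡ h))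
  in x , x∈xs , Equivalence.to BoolP.T-≡ px

any≡true⁺ : ∀ {a} {T : Set a} (p : T → Bool) {x xs} → x ∈ₗ xs → p x ≡ true → any p xs ≡ true
any≡true⁺ p x∈xs px =
  Equivalence.to BoolP.T-≡ (AnyP.any⁺ p (lose x∈xs (Equivalence.from BoolP.T-≡ px)))

length-partition : ∀ {a p} {T : Set a} {P : Pred T p} (P? : Decidable P) xs →
  length (filter P? xs) + length (filter (∁? P?) xs) ≡ length xs
length-partition P? [] = refl
length-partition P? (x ∷ xs) with P? x
... | yes _ = cong suc (length-partition P? xs)
... | no _ = trans (ℕP.+-suc _ _) (cong suc (length-partition P? xs))

indicators-≤ : ∀ {p q r s} → p ≤ 1 → q ≤ 1 →
  (1 ≤ p → 1 ≤ r + s) → (1 ≤ q → 1 ≤ r + s) → (1 ≤ p → 1 ≤ q → 1 ≤ r × 1 ≤ s) →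
  p + q ≤ r + s
indicators-≤ {zero} {zero} _ _ _ _ _ = z≤n
indicators-≤ {zero} {suc zero} _ _ _ q⇒ _ = q⇒ (s≤s z≤n)
indicators-≤ {suc zero} {zero} _ _ p⇒ _ _ = p⇒ (s≤s z≤n)
indicators-≤ {suc zero} {suc zero} _ _ _ _ pq⇒ =
  let (r≥1 , s≥1) = pq⇒ (s≤s z≤n) (s≤s z≤n) in ℕP.+-mono-≤ r≥1 s≥1
indicators-≤ {suc (suc _)} (s≤s ())
indicators-≤ {_} {suc (suc _)} _ (s≤s ())

1≤+ : ∀ {r s} → 1 ≤ r ⊎ 1 ≤ s → 1 ≤ r + s
1≤+ {r} (inj₁ r≥1) = ℕP.≤-trans r≥1 (ℕP.m≤m+n r _)
1≤+ {r} (inj₂ s≥1) = ℕP.≤-trans s≥1 (ℕP.m≤n+m _ r)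

module _ {n : ℕ} where

  ∈⋃⁻ : ∀ P {x : Fin n} → x ∈ ⋃ P → Σ (Subset n) λ C → C ∈ₗ P × x ∈ C
  ∈⋃⁻ [] x∈ = ⊥-elim (∉⊥ x∈)
  ∈⋃⁻ (C ∷ P) x∈ with x∈p∪q⁻ C (⋃ P) x∈
  ... | inj₁ x∈C = C , here refl , x∈C
  ... | inj₂ x∈⋃P = let (D , D∈P , x∈D) = ∈⋃⁻ P x∈⋃P in D , there D∈P , x∈D

  ∈⋃⁺ : ∀ P {x : Fin n} {C} → C ∈ₗ P → x ∈ C → x ∈ ⋃ P
  ∈⋃⁺ (C ∷ P) (here refl) x∈C = x∈p∪q⁺ (inj₁ x∈C)
  ∈⋃⁺ (_ ∷ P) (there C∈P) x∈C = x∈p∪q⁺ (inj₂ (∈⋃⁺ P C∈P x∈C))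

  ⋃-mono : ∀ {L M : List (Subset n)} → (∀ {C} → C ∈ₗ L → C ∈ₗ M) → ⋃ L ⊆ ⋃ M
  ⋃-mono {L} {M} L⊆M x∈ = let (C , C∈L , x∈C) = ∈⋃⁻ L x∈ in ∈⋃⁺ M (L⊆M C∈L) x∈C

  ∈⋃-++⁻ : ∀ L {M} {x : Fin n} → x ∈ ⋃ (L ++ M) → x ∈ ⋃ L ⊎ x ∈ ⋃ M
  ∈⋃-++⁻ L {M} x∈ with ∈⋃⁻ (L ++ M) x∈
  ... | C , C∈ , x∈C with ∈-++⁻ L C∈
  ...   | inj₁ C∈L = inj₁ (∈⋃⁺ L C∈L x∈C)
  ...   | inj₂ C∈M = inj₂ (∈⋃⁺ M C∈M x∈C)

  block-unique : ∀ {P C D} {x : Fin n} → AllPairs Disjoint P →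
    C ∈ₗ P → D ∈ₗ P → x ∈ C → x ∈ D → C ≡ D
  block-unique (_ AllPairs.∷ _) (here refl) (here refl) _ _ = refl
  block-unique {x = x} (C#P AllPairs.∷ _) (here refl) (there D∈P) x∈C x∈D =
    ⊥-elim (All.lookup C#P D∈P x x∈C x∈D)
  block-unique {x = x} (D#P AllPairs.∷ _) (there C∈P) (here refl) x∈C x∈D =
    ⊥-elim (All.lookup D#P C∈P x x∈D x∈C)
  block-unique (_ AllPairs.∷ disj) (there C∈P) (there D∈P) x∈C x∈D =
    block-unique disj C∈P D∈P x∈C x∈D

  Refines : List (Subset n) → List (Subset n) → Set
  Refines F P = ∀ {X} → X ∈ₗ F → Σ (Subset n) λ C → C ∈ₗ P × X ⊆ C

  Together : List (Subset n) → Fin n → Fin n → Set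
  Together P a b = Σ (Subset n) λ C → C ∈ₗ P × a ∈ C × b ∈ C

  Separates : List (Subset n) → Fin n → Fin n → Set
  Separates P a b = Σ (Subset n) λ C → C ∈ₗ P × a ∈ C × b ∉ C

  Splits : List (Subset n) → Fin n → Fin n → Set
  Splits P a b = Separates P a b ⊎ Separates P b a

  ⋃-refines : ∀ {F P} → Refines F P → ⋃ F ⊆ ⋃ P
  ⋃-refines {F} {P} F≤P x∈ =
    let (X , X∈F , x∈X) = ∈⋃⁻ F x∈ ; (C , C∈P , X⊆C) = F≤P X∈F in ∈⋃⁺ P C∈P (X⊆C x∈X)

  refines-trans : ∀ {F P R} → Refines F P → Refines P R → Refines F R
  refines-trans F≤P P≤R X∈F =
    let (C , C∈P , X⊆C) = F≤P X∈F ; (D , D∈R , C⊆D) = P≤R C∈P in D , D∈R , C⊆D ∘ X⊆C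

  together-refines : ∀ {F P} {a b : Fin n} → Refines F P → Together F a b → Together P a b
  together-refines F≤P (X , X∈F , a∈X , b∈X) =
    let (C , C∈P , X⊆C) = F≤P X∈F in C , C∈P , X⊆C a∈X , X⊆C b∈X

  together-sym : ∀ {P} {a b : Fin n} → Together P a b → Together P b a
  together-sym (C , C∈P , a∈C , b∈C) = C , C∈P , b∈C , a∈C

  splits-sym : ∀ {P} {a b : Fin n} → Splits P a b → Splits P b a
  splits-sym = Data.Sum.swap

  separates⇒∈⋃ : ∀ {P} {a b : Fin n} → Separates P a b → a ∈ ⋃ P
  separates⇒∈⋃ {P} (C , C∈P , a∈C , _) = ∈⋃⁺ P C∈P a∈C

  separates-intro : ∀ {P} {a b : Fin n} → a ∈ ⋃ P → ¬ Together P a b → Separates P a b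
  separates-intro {P} {b = b} a∈ apart with ∈⋃⁻ P a∈
  ... | C , C∈P , a∈C with b ∈? C
  ...   | yes b∈C = ⊥-elim (apart (C , C∈P , a∈C , b∈C))
  ...   | no b∉C = C , C∈P , a∈C , b∉C

  separates-refines : ∀ {F P} {a b : Fin n} → Refines F P → a ∈ ⋃ F → ¬ Together P a b →
    Separates F a b
  separates-refines F≤P a∈ apart = separates-intro a∈ (apart ∘ together-refines F≤P)

  separates⇒apart : ∀ {P} {a b : Fin n} → AllPairs Disjoint P → Separates P a b → ¬ Together P a b
  separates⇒apart disj (C , C∈P , a∈C , b∉C) (D , D∈P , a∈D , b∈D)
    with block-unique disj C∈P D∈P a∈C a∈D
  ... | refl = b∉C b∈D

  splits⇒apart : ∀ {P} {a b : Fin n} → AllPairs Disjoint P → Splits P a b → ¬ Together P a b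
  splits⇒apart disj (inj₁ sep) = separates⇒apart disj sep
  splits⇒apart disj (inj₂ sep) = separates⇒apart disj sep ∘ together-sym

record Uncrossing {n} (F₁ F₂ P Q : List (Subset n)) : Set where
  field
    P-family : IsFamily P
    Q-family : IsFamily Q
    P-covered : ⋃ P ⊆ ⋃ F₁ ∪ ⋃ F₂
    Q-covered : ⋃ Q ⊆ ⋃ F₁ ∩ ⋃ F₂
    F₁-refines : Refines F₁ P
    F₂-refines : Refines F₂ P
    meets-refine : ∀ {X Y} → X ∈ₗ F₁ → Y ∈ₗ F₂ → Nonempty (X ∩ Y) →
      Σ (Subset n) λ D → D ∈ₗ Q × X ∩ Y ⊆ D
    size : length P + length Q ≡ length F₁ + length F₂

  ⋃P≡ : ⋃ P ≡ ⋃ F₁ ∪ ⋃ F₂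
  ⋃P≡ = ⊆-antisym P-covered λ x∈ →
    [ ⋃-refines F₁-refines , ⋃-refines F₂-refines ] (x∈p∪q⁻ (⋃ F₁) (⋃ F₂) x∈)

  ⋃Q≡ : ⋃ Q ≡ ⋃ F₁ ∩ ⋃ F₂
  ⋃Q≡ = ⊆-antisym Q-covered λ {x} x∈ →
    let (x∈⋃F₁ , x∈⋃F₂) = x∈p∩q⁻ (⋃ F₁) (⋃ F₂) x∈
        (X , X∈F₁ , x∈X) = ∈⋃⁻ F₁ x∈⋃F₁
        (Y , Y∈F₂ , x∈Y) = ∈⋃⁻ F₂ x∈⋃F₂
        x∈X∩Y = x∈p∩q⁺ (x∈X , x∈Y)
        (D , D∈Q , X∩Y⊆D) = meets-refine X∈F₁ Y∈F₂ (x , x∈X∩Y)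
    in ∈⋃⁺ Q D∈Q (X∩Y⊆D x∈X∩Y)

-- Adding a block Y to the second family: the blocks of P meeting Y are merged
-- with Y into one block, and their traces on Y become new blocks of Q.
module _ {n : ℕ} where

  Meets : Subset n → Subset n → Set
  Meets Y C = Nonempty (Y ∩ C)

  meets? : ∀ Y → Decidable (Meets Y)
  meets? Y C = nonempty? (Y ∩ C)

  meeting avoiding : Subset n → List (Subset n) → List (Subset n)
  meeting Y = filter (meets? Y)
  avoiding Y = filter (∁? (meets? Y))

  mergeP : Subset n → List (Subset n) → List (Subset n)
  mergeP Y P = ⋃ (Y ∷ meeting Y P) ∷ avoiding Y P

  extendQ : Subset n → List (Subset n) → List (Subset n) → List (Subset n)
  extendQ Y P Q = map (Y ∩_) (meeting Y P) ++ Q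

  meeting⊆ : ∀ Y P {C} → C ∈ₗ meeting Y P → C ∈ₗ P
  meeting⊆ Y P = proj₁ ∘ ∈-filter⁻ (meets? Y)

  avoiding⊆ : ∀ Y P {C} → C ∈ₗ avoiding Y P → C ∈ₗ P
  avoiding⊆ Y P = proj₁ ∘ ∈-filter⁻ (∁? (meets? Y))

  merge-refines : ∀ Y P → Refines P (mergeP Y P)
  merge-refines Y P {C} C∈P with meets? Y C
  ... | yes meets = ⋃ (Y ∷ meeting Y P) , here refl ,
        λ x∈C → x∈p∪q⁺ (inj₂ (∈⋃⁺ (meeting Y P) (∈-filter⁺ (meets? Y) C∈P meets) x∈C))
  ... | no avoids = C , there (∈-filter⁺ (∁? (meets? Y)) C∈P avoids) , id

  merge-covered : ∀ Y P → ⋃ (mergeP Y P) ⊆ Y ∪ ⋃ P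
  merge-covered Y P x∈ with x∈p∪q⁻ (⋃ (Y ∷ meeting Y P)) _ x∈
  ... | inj₂ x∈avoiding = x∈p∪q⁺ (inj₂ (⋃-mono (avoiding⊆ Y P) x∈avoiding))
  ... | inj₁ x∈merged with x∈p∪q⁻ Y _ x∈merged
  ...   | inj₁ x∈Y = x∈p∪q⁺ (inj₁ x∈Y)
  ...   | inj₂ x∈meeting = x∈p∪q⁺ (inj₂ (⋃-mono (meeting⊆ Y P) x∈meeting))

  ⋃-traces : ∀ Y (L : List (Subset n)) {x} → x ∈ ⋃ (map (Y ∩_) L) → x ∈ Y × x ∈ ⋃ L
  ⋃-traces Y [] x∈ = ⊥-elim (∉⊥ x∈)
  ⋃-traces Y (C ∷ L) x∈ with x∈p∪q⁻ (Y ∩ C) _ x∈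
  ... | inj₁ x∈Y∩C = let (x∈Y , x∈C) = x∈p∩q⁻ Y C x∈Y∩C in x∈Y , x∈p∪q⁺ (inj₁ x∈C)
  ... | inj₂ x∈rest = let (x∈Y , x∈⋃L) = ⋃-traces Y L x∈rest in x∈Y , x∈p∪q⁺ (inj₂ x∈⋃L)

  merged-disjoint : ∀ Y {P C} → AllPairs Disjoint P → C ∈ₗ avoiding Y P →
    Disjoint (⋃ (Y ∷ meeting Y P)) C
  merged-disjoint Y disj C∈ x x∈merged x∈C with ∈-filter⁻ (∁? (meets? Y)) C∈
  ... | C∈P , avoids with x∈p∪q⁻ Y _ x∈merged
  ...   | inj₁ x∈Y = avoids (x , x∈p∩q⁺ (x∈Y , x∈C))
  ...   | inj₂ x∈meeting with ∈⋃⁻ _ x∈meeting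
  ...     | D , D∈ , x∈D with ∈-filter⁻ (meets? Y) D∈
  ...       | D∈P , meets with block-unique disj D∈P C∈P x∈D x∈C
  ...         | refl = avoids meets

  merge-family : ∀ {Y P} → Nonempty Y → IsFamily P → IsFamily (mergeP Y P)
  merge-family {Y} (y , y∈Y) (disj , nonempty) =
    (All.tabulate (merged-disjoint Y disj) AllPairs.∷ AllPairsP.filter⁺ (∁? (meets? Y)) disj) ,
    (y , x∈p∪q⁺ (inj₁ y∈Y)) All.∷ AllP.filter⁺ (∁? (meets? Y)) nonempty

  traces-family : ∀ {Y P} → AllPairs Disjoint P → IsFamily (map (Y ∩_) (meeting Y P))
  traces-family {Y} {P} disj =
    AllPairsP.map⁺ (AllPairsP.filter⁺ (meets? Y) (AllPairs.map traces-disjoint disj)) ,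
    AllP.map⁺ (AllP.all-filter (meets? Y) P)
    where
    traces-disjoint : ∀ {C D} → Disjoint C D → Disjoint (Y ∩ C) (Y ∩ D)
    traces-disjoint C#D x x∈Y∩C x∈Y∩D =
      C#D x (proj₂ (x∈p∩q⁻ Y _ x∈Y∩C)) (proj₂ (x∈p∩q⁻ Y _ x∈Y∩D))

  -- each merged block is traded for one trace, and one merged block is added
  merge-size : ∀ Y P Q → length (mergeP Y P) + length (extendQ Y P Q) ≡ suc (length P + length Q)
  merge-size Y P Q = begin
    suc (length (avoiding Y P) + length (map (Y ∩_) (meeting Y P) ++ Q))
      ≡⟨ cong (λ m → suc (length (avoiding Y P) + m))
           (trans (ListP.length-++ (map (Y ∩_) (meeting Y P)))
                  (cong (_+ length Q) (ListP.length-map (Y ∩_) (meeting Y P)))) ⟩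
    suc (length (avoiding Y P) + (length (meeting Y P) + length Q))
      ≡⟨ cong suc (trans (sym (ℕP.+-assoc (length (avoiding Y P)) _ _))
                          (cong (_+ length Q) (ℕP.+-comm (length (avoiding Y P)) _))) ⟩
    suc (length (meeting Y P) + length (avoiding Y P) + length Q)
      ≡⟨ cong (λ m → suc (m + length Q)) (length-partition (meets? Y) P) ⟩
    suc (length P + length Q) ∎
    where open ≡-Reasoning

  uncross-init : ∀ {F₁ : List (Subset n)} → IsFamily F₁ → Uncrossing F₁ [] F₁ []
  uncross-init fam = record
    { P-family = fam
    ; Q-family = AllPairs.[] , All.[]
    ; P-covered = λ x∈ → x∈p∪q⁺ (inj₁ x∈)
    ; Q-covered = λ x∈ → ⊥-elim (∉⊥ x∈)
    ; F₁-refines = λ {X} X∈ → X , X∈ , id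
    ; F₂-refines = λ ()
    ; meets-refine = λ _ ()
    ; size = refl
    }

  uncross-step : ∀ {F₁ F₂ P Q : List (Subset n)} {Y} → Uncrossing F₁ F₂ P Q →
    Nonempty Y → All (Disjoint Y) F₂ →
    Uncrossing F₁ (Y ∷ F₂) (mergeP Y P) (extendQ Y P Q)
  uncross-step {F₁} {F₂} {P} {Q} {Y} U Y-nonempty Y-new = record
    { P-family = merge-family Y-nonempty P-family
    ; Q-family = AllPairsP.++⁺ (proj₁ traces) (proj₁ Q-family)
                   (AllP.map⁺ (All.tabulate λ _ → All.tabulate trace-avoids-Q))
               , AllP.++⁺ (proj₂ traces) (proj₂ Q-family)
    ; P-covered = λ x∈ → [ (λ x∈Y → x∈p∪q⁺ (inj₂ (x∈p∪q⁺ (inj₁ x∈Y))))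
                         , [ x∈p∪q⁺ ∘ inj₁ , x∈p∪q⁺ ∘ inj₂ ∘ x∈p∪q⁺ ∘ inj₂ ]
                           ∘ x∈p∪q⁻ (⋃ F₁) (⋃ F₂) ∘ P-covered ]
                         (x∈p∪q⁻ Y (⋃ P) (merge-covered Y P x∈))
    ; Q-covered = Q-covered′
    ; F₁-refines = refines-trans F₁-refines (merge-refines Y P)
    ; F₂-refines = λ { (here refl) → ⋃ (Y ∷ meeting Y P) , here refl , x∈p∪q⁺ ∘ inj₁
                     ; (there Z∈F₂) → refines-trans F₂-refines (merge-refines Y P) Z∈F₂ }
    ; meets-refine = meets-refine′
    ; size = trans (merge-size Y P Q) (trans (cong suc size) (sym (ℕP.+-suc (length F₁) _)))
    }
    where
    open Uncrossing U
    traces = traces-family {Y} (proj₁ P-family)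

    Y-avoids-F₂ : ∀ {x} → x ∈ Y → x ∉ ⋃ F₂
    Y-avoids-F₂ x∈Y x∈⋃F₂ =
      let (Z , Z∈F₂ , x∈Z) = ∈⋃⁻ F₂ x∈⋃F₂ in All.lookup Y-new Z∈F₂ _ x∈Y x∈Z

    trace-avoids-Q : ∀ {C D} → D ∈ₗ Q → Disjoint (Y ∩ C) D
    trace-avoids-Q {C} D∈Q x x∈Y∩C x∈D =
      Y-avoids-F₂ (proj₁ (x∈p∩q⁻ Y C x∈Y∩C))
        (proj₂ (x∈p∩q⁻ (⋃ F₁) (⋃ F₂) (Q-covered (∈⋃⁺ Q D∈Q x∈D))))

    Q-covered′ : ⋃ (extendQ Y P Q) ⊆ ⋃ F₁ ∩ (Y ∪ ⋃ F₂)
    Q-covered′ x∈ with ∈⋃-++⁻ (map (Y ∩_) (meeting Y P)) x∈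
    ... | inj₁ x∈traces =
      let (x∈Y , x∈⋃meeting) = ⋃-traces Y (meeting Y P) x∈traces
          x∈⋃F₁ = [ id , ⊥-elim ∘ Y-avoids-F₂ x∈Y ]
                    (x∈p∪q⁻ (⋃ F₁) (⋃ F₂) (P-covered (⋃-mono (meeting⊆ Y P) x∈⋃meeting)))
      in x∈p∩q⁺ (x∈⋃F₁ , x∈p∪q⁺ (inj₁ x∈Y))
    ... | inj₂ x∈⋃Q =
      let (x∈⋃F₁ , x∈⋃F₂) = x∈p∩q⁻ (⋃ F₁) (⋃ F₂) (Q-covered x∈⋃Q)
      in x∈p∩q⁺ (x∈⋃F₁ , x∈p∪q⁺ (inj₂ x∈⋃F₂))

    meets-refine′ : ∀ {X Z} → X ∈ₗ F₁ → Z ∈ₗ Y ∷ F₂ → Nonempty (X ∩ Z) →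
      Σ (Subset n) λ D → D ∈ₗ extendQ Y P Q × X ∩ Z ⊆ D
    meets-refine′ X∈F₁ (here refl) (x , x∈X∩Y) =
      let (x∈X , x∈Y) = x∈p∩q⁻ _ Y x∈X∩Y
          (C , C∈P , X⊆C) = F₁-refines X∈F₁
          C∈meeting = ∈-filter⁺ (meets? Y) C∈P (x , x∈p∩q⁺ (x∈Y , X⊆C x∈X))
      in Y ∩ C , ∈-++⁺ˡ (∈-map⁺ (Y ∩_) C∈meeting) ,
         λ z∈X∩Y → let (z∈X , z∈Y) = x∈p∩q⁻ _ Y z∈X∩Y in x∈p∩q⁺ (z∈Y , X⊆C z∈X)
    meets-refine′ X∈F₁ (there Z∈F₂) X∩Z≠∅ =
      let (D , D∈Q , X∩Z⊆D) = meets-refine X∈F₁ Z∈F₂ X∩Z≠∅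
      in D , ∈-++⁺ʳ (map (Y ∩_) (meeting Y P)) D∈Q , X∩Z⊆D

  uncross : ∀ {F₁ F₂ : List (Subset n)} → IsFamily F₁ → IsFamily F₂ →
    Σ (List (Subset n)) λ P → Σ (List (Subset n)) λ Q → Uncrossing F₁ F₂ P Q
  uncross {F₁} {[]} fam₁ _ = F₁ , [] , uncross-init fam₁
  uncross {F₁} {Y ∷ F₂} fam₁ (Y-new AllPairs.∷ disj , Y-nonempty All.∷ nonempty) =
    let (P , Q , U) = uncross fam₁ (disj , nonempty)
    in mergeP Y P , extendQ Y P Q , uncross-step U Y-nonempty Y-new

module _ {n} {F₁ F₂ P Q : List (Subset n)} (U : Uncrossing F₁ F₂ P Q) where
  open Uncrossing U

  separates-P : ∀ {a b} → Separates P a b → Separates F₁ a b ⊎ Separates F₂ a b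
  separates-P sep =
    Data.Sum.map (λ a∈⋃F₁ → separates-refines F₁-refines a∈⋃F₁ apart)
                 (λ a∈⋃F₂ → separates-refines F₂-refines a∈⋃F₂ apart)
                 (x∈p∪q⁻ (⋃ F₁) (⋃ F₂) (P-covered (separates⇒∈⋃ sep)))
    where apart = separates⇒apart (proj₁ P-family) sep

  -- so is an intersection block: a and b cannot share both a block of F₁ and one of F₂
  separates-Q : ∀ {a b} → Separates Q a b → Separates F₁ a b ⊎ Separates F₂ a b
  separates-Q {a} {b} sep with x∈p∩q⁻ (⋃ F₁) (⋃ F₂) (Q-covered (separates⇒∈⋃ sep))
  ... | a∈⋃F₁ , a∈⋃F₂ with ∈⋃⁻ F₁ a∈⋃F₁
  ...   | X , X∈F₁ , a∈X with b ∈? X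
  ...     | no b∉X = inj₁ (X , X∈F₁ , a∈X , b∉X)
  ...     | yes b∈X = inj₂ (separates-intro a∈⋃F₂ λ (Y , Y∈F₂ , a∈Y , b∈Y) →
    let (D , D∈Q , X∩Y⊆D) = meets-refine X∈F₁ Y∈F₂ (a , x∈p∩q⁺ (a∈X , a∈Y))
    in separates⇒apart (proj₁ Q-family) sep
         (D , D∈Q , X∩Y⊆D (x∈p∩q⁺ (a∈X , a∈Y)) , X∩Y⊆D (x∈p∩q⁺ (b∈X , b∈Y))))

  separates-PQ : ∀ {a b} → ¬ Together P a b → Separates Q a b →
    Separates F₁ a b × Separates F₂ a b
  separates-PQ apart sep =
    let (a∈⋃F₁ , a∈⋃F₂) = x∈p∩q⁻ (⋃ F₁) (⋃ F₂) (Q-covered (separates⇒∈⋃ sep))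
    in separates-refines F₁-refines a∈⋃F₁ apart , separates-refines F₂-refines a∈⋃F₂ apart

  splits-P : ∀ {a b} → Splits P a b → Splits F₁ a b ⊎ Splits F₂ a b
  splits-P (inj₁ sep) = Data.Sum.map inj₁ inj₁ (separates-P sep)
  splits-P (inj₂ sep) = Data.Sum.map inj₂ inj₂ (separates-P sep)

  splits-Q : ∀ {a b} → Splits Q a b → Splits F₁ a b ⊎ Splits F₂ a b
  splits-Q (inj₁ sep) = Data.Sum.map inj₁ inj₁ (separates-Q sep)
  splits-Q (inj₂ sep) = Data.Sum.map inj₂ inj₂ (separates-Q sep)

  splits-PQ : ∀ {a b} → Splits P a b → Splits Q a b → Splits F₁ a b × Splits F₂ a b
  splits-PQ split (inj₁ sep) =
    Data.Product.map inj₁ inj₁ (separates-PQ (splits⇒apart (proj₁ P-family) split) sep)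
  splits-PQ split (inj₂ sep) =
    Data.Product.map inj₂ inj₂
      (separates-PQ (splits⇒apart (proj₁ P-family) split ∘ together-sym) sep)

module _ {n : ℕ} where

  separatesᵇ : Subset n → Fin n → Fin n → Bool
  separatesᵇ X a b = (a ∈ᵇ X) ∧ not (b ∈ᵇ X)

  separatesᵇ⁻ : ∀ X {a b} → separatesᵇ X a b ≡ true → a ∈ X × b ∉ X
  separatesᵇ⁻ X {a} {b} h with lookup X a in a∈ | lookup X b in b∈
  separatesᵇ⁻ X {a} {b} refl | true | false =
    VecP.lookup⇒[]= a X a∈ , λ b∈X → BoolP.not-¬ (VecP.[]=⇒lookup b∈X) b∈

  separatesᵇ⁺ : ∀ X {a b} → a ∈ X → b ∉ X → separatesᵇ X a b ≡ true
  separatesᵇ⁺ X {a} {b} a∈X b∉X rewrite VecP.[]=⇒lookup a∈X with lookup X b in b∈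
  ... | true = ⊥-elim (b∉X (VecP.lookup⇒[]= b X b∈))
  ... | false = refl

  crossing : List (Subset n) → Fin n × Fin n → ℕ
  crossing P e = ind (crosses P e)

  crossing-pos⁻ : ∀ P {u v} → 1 ≤ crossing P (u , v) → Splits P u v
  crossing-pos⁻ P {u} {v} pos with any≡true⁻ (λ X → separatesᵇ X u v ∨ separatesᵇ X v u) P (ind-pos⁻ pos)
  ... | X , X∈P , h with separatesᵇ X u v in uv
  ...   | true = inj₁ (X , X∈P , separatesᵇ⁻ X uv)
  ...   | false = inj₂ (X , X∈P , separatesᵇ⁻ X h)

  crossing-pos⁺ : ∀ P {u v} → Splits P u v → 1 ≤ crossing P (u , v)
  crossing-pos⁺ P {u} {v} (inj₁ (X , X∈P , u∈X , v∉X)) =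
    ind-pos⁺ (any≡true⁺ _ X∈P (cong (_∨ separatesᵇ X v u) (separatesᵇ⁺ X u∈X v∉X)))
  crossing-pos⁺ P {u} {v} (inj₂ (X , X∈P , v∈X , u∉X)) =
    ind-pos⁺ (any≡true⁺ _ X∈P
      (trans (cong (separatesᵇ X u v ∨_) (separatesᵇ⁺ X v∈X u∉X)) (BoolP.∨-zeroʳ _)))

  enters : Subset n → Fin n × Fin n → Bool
  enters X a = not (proj₁ a ∈ᵇ X) ∧ (proj₂ a ∈ᵇ X)

  entered : List (Subset n) → Fin n × Fin n → ℕ
  entered P a = total (λ X → ind (enters X a)) P

  entered-pos⁻ : ∀ P {s t} → 1 ≤ entered P (s , t) → Separates P t s
  entered-pos⁻ P {s} {t} pos =
    let (X , X∈P , h) = total-ind-pos⁻ (λ X → enters X (s , t)) P pos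
    in X , X∈P , separatesᵇ⁻ X (trans (BoolP.∧-comm (t ∈ᵇ X) _) h)

  entered-pos⁺ : ∀ P {s t} → Separates P t s → 1 ≤ entered P (s , t)
  entered-pos⁺ P {s} {t} (X , X∈P , t∈X , s∉X) =
    total-ind-pos⁺ (λ X → enters X (s , t)) P X∈P
      (trans (BoolP.∧-comm (not (s ∈ᵇ X)) _) (separatesᵇ⁺ X t∈X s∉X))

  entered-≤1 : ∀ {P} a → AllPairs Disjoint P → entered P a ≤ 1
  entered-≤1 {P} (s , t) disj = total-ind-≤1 (λ X → enters X (s , t))
    (AllPairs.map (λ {X} {Y} X#Y eX eY → X#Y t (head∈ X eX) (head∈ Y eY)) disj)
    where
    head∈ : ∀ X → enters X (s , t) ≡ true → t ∈ X
    head∈ X e = proj₁ (separatesᵇ⁻ X (trans (BoolP.∧-comm (t ∈ᵇ X) _) e))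

  lhs-split : ∀ (F : MixedGraph n) P → lhs F P ≡ total (crossing P) (E F) + total (entered P) (A F)
  lhs-split F P = cong₂ _+_ (count≡total (crosses P) (E F)) (begin
    total (dA⁻ F) P
      ≡⟨ total-cong P (λ X → count≡total (enters X) (A F)) ⟩
    total (λ X → total (λ a → ind (enters X a)) (A F)) P
      ≡⟨ total-swap (λ X a → ind (enters X a)) P (A F) ⟩
    total (entered P) (A F) ∎)
    where open ≡-Reasoning

module _ {n} {F₁ F₂ P Q : List (Subset n)} (U : Uncrossing F₁ F₂ P Q) where
  open Uncrossing U

  crossing-≤ : ∀ e → crossing P e + crossing Q e ≤ crossing F₁ e + crossing F₂ e
  crossing-≤ (u , v) = indicators-≤ (ind≤1 _) (ind≤1 _)
    (witnessed ∘ splits-P U ∘ crossing-pos⁻ P)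
    (witnessed ∘ splits-Q U ∘ crossing-pos⁻ Q)
    (λ p q → Data.Product.map (crossing-pos⁺ F₁) (crossing-pos⁺ F₂)
               (splits-PQ U (crossing-pos⁻ P p) (crossing-pos⁻ Q q)))
    where
    witnessed : Splits F₁ u v ⊎ Splits F₂ u v → 1 ≤ crossing F₁ (u , v) + crossing F₂ (u , v)
    witnessed = 1≤+ ∘ Data.Sum.map (crossing-pos⁺ F₁) (crossing-pos⁺ F₂)

  entered-≤ : ∀ a → entered P a + entered Q a ≤ entered F₁ a + entered F₂ a
  entered-≤ (s , t) = indicators-≤ (entered-≤1 (s , t) (proj₁ P-family)) (entered-≤1 (s , t) (proj₁ Q-family))
    (witnessed ∘ separates-P U ∘ entered-pos⁻ P)
    (witnessed ∘ separates-Q U ∘ entered-pos⁻ Q)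
    (λ p q → let sepP = entered-pos⁻ P p in
      Data.Product.map (entered-pos⁺ F₁) (entered-pos⁺ F₂)
        (separates-PQ U (separates⇒apart (proj₁ P-family) sepP) (entered-pos⁻ Q q)))
    where
    witnessed : Separates F₁ t s ⊎ Separates F₂ t s → 1 ≤ entered F₁ (s , t) + entered F₂ (s , t)
    witnessed = 1≤+ ∘ Data.Sum.map (entered-pos⁺ F₁) (entered-pos⁺ F₂)

  crossing-< : ∀ a b → Splits F₁ a b → Splits F₂ a b → ¬ Splits Q a b →
    crossing P (a , b) + crossing Q (a , b) < crossing F₁ (a , b) + crossing F₂ (a , b)
  crossing-< a b split₁ split₂ ¬splitQ with crosses Q (a , b) in crossesQ
  ... | true = ⊥-elim (¬splitQ (crossing-pos⁻ Q (ind-pos⁺ crossesQ)))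
  ... | false = begin-strict
    crossing P (a , b) + 0                     ≡⟨ ℕP.+-identityʳ _ ⟩
    crossing P (a , b)                         ≤⟨ ind≤1 _ ⟩
    1                                          <⟨ ℕP.≤-refl ⟩
    1 + 1                                      ≤⟨ ℕP.+-mono-≤ (crossing-pos⁺ F₁ split₁) (crossing-pos⁺ F₂ split₂) ⟩
    crossing F₁ (a , b) + crossing F₂ (a , b)  ∎
    where open ℕP.≤-Reasoning

  between-splits : ∀ {u v} → u ∈ ⋃ F₁ → u ∉ ⋃ F₂ → v ∈ ⋃ F₂ → v ∉ ⋃ F₁ →
    Splits F₁ u v × Splits F₂ u v × ¬ Splits Q u v
  between-splits u∈⋃F₁ u∉⋃F₂ v∈⋃F₂ v∉⋃F₁ =
    let (X , X∈F₁ , u∈X) = ∈⋃⁻ F₁ u∈⋃F₁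
        (Y , Y∈F₂ , v∈Y) = ∈⋃⁻ F₂ v∈⋃F₂
    in inj₁ (X , X∈F₁ , u∈X , v∉⋃F₁ ∘ ∈⋃⁺ F₁ X∈F₁) ,
       inj₂ (Y , Y∈F₂ , v∈Y , u∉⋃F₂ ∘ ∈⋃⁺ F₂ Y∈F₂) ,
       [ u∉⋃F₂ ∘ proj₂ ∘ in-both , v∉⋃F₁ ∘ proj₁ ∘ in-both ]
    where
    in-both : ∀ {a b} → Separates Q a b → a ∈ ⋃ F₁ × a ∈ ⋃ F₂
    in-both = x∈p∩q⁻ (⋃ F₁) (⋃ F₂) ∘ Q-covered ∘ separates⇒∈⋃

  crossing-edge-< : ∀ {u v e} → u ∈ ⋃ F₁ → u ∉ ⋃ F₂ → v ∈ ⋃ F₂ → v ∉ ⋃ F₁ →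
    e ≡ (u , v) ⊎ e ≡ (v , u) →
    crossing P e + crossing Q e < crossing F₁ e + crossing F₂ e
  crossing-edge-< {u} {v} u∈⋃F₁ u∉⋃F₂ v∈⋃F₂ v∉⋃F₁ (inj₁ refl) =
    let (split₁ , split₂ , ¬splitQ) = between-splits u∈⋃F₁ u∉⋃F₂ v∈⋃F₂ v∉⋃F₁
    in crossing-< u v split₁ split₂ ¬splitQ
  crossing-edge-< {u} {v} u∈⋃F₁ u∉⋃F₂ v∈⋃F₂ v∉⋃F₁ (inj₂ refl) =
    let (split₁ , split₂ , ¬splitQ) = between-splits u∈⋃F₁ u∉⋃F₂ v∈⋃F₂ v∉⋃F₁
    in crossing-< v u (splits-sym split₁) (splits-sym split₂) (¬splitQ ∘ splits-sym)

  lhs-uncross-< : ∀ (F : MixedGraph n) {e u v} → e ∈ₗ E F → e ≡ (u , v) ⊎ e ≡ (v , u) →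
    u ∈ ⋃ F₁ → u ∉ ⋃ F₂ → v ∈ ⋃ F₂ → v ∉ ⋃ F₁ →
    lhs F P + lhs F Q < lhs F F₁ + lhs F F₂
  lhs-uncross-< F e∈E e≡ u∈⋃F₁ u∉⋃F₂ v∈⋃F₂ v∉⋃F₁ = begin-strict
    lhs F P + lhs F Q                                ≡⟨ cong₂ _+_ (lhs-split F P) (lhs-split F Q) ⟩
    (edges P + arcs P) + (edges Q + arcs Q)          ≡⟨ +-interchange (edges P) _ _ _ ⟩
    (edges P + edges Q) + (arcs P + arcs Q)          <⟨ ℕP.+-mono-<-≤ edges-< arcs-≤ ⟩
    (edges F₁ + edges F₂) + (arcs F₁ + arcs F₂)      ≡⟨ +-interchange (edges F₁) _ _ _ ⟩
    (edges F₁ + arcs F₁) + (edges F₂ + arcs F₂)      ≡⟨ cong₂ _+_ (lhs-split F F₁) (lhs-split F F₂) ⟨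
    lhs F F₁ + lhs F F₂                              ∎
    where
    open ℕP.≤-Reasoning
    edges arcs : List (Subset n) → ℕ
    edges R = total (crossing R) (E F)
    arcs R = total (entered R) (A F)
    edges-< : edges P + edges Q < edges F₁ + edges F₂
    edges-< = total₂-mono-< (E F) (λ {e} _ → crossing-≤ e) e∈E
                (crossing-edge-< u∈⋃F₁ u∉⋃F₂ v∈⋃F₂ v∉⋃F₁ e≡)
    arcs-≤ : arcs P + arcs Q ≤ arcs F₁ + arcs F₂
    arcs-≤ = total₂-mono (A F) (λ {a} _ → entered-≤ a)

module _ {n : ℕ} where

  restrict : (Fin n → ℕ) → Subset n → Fin n → ℕ
  restrict h X x = if x ∈ᵇ X then h x else 0

  tilde₂-≤ : ∀ h₁ (X₁ : Subset n) h₂ X₂ h₃ X₃ h₄ X₄ →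
    (∀ x → restrict h₁ X₁ x + restrict h₂ X₂ x ≤ restrict h₃ X₃ x + restrict h₄ X₄ x) →
    tilde h₁ X₁ + tilde h₂ X₂ ≤ tilde h₃ X₃ + tilde h₄ X₄
  tilde₂-≤ _ _ _ _ _ _ _ _ pointwise = total₂-mono (allFin n) (λ {x} _ → pointwise x)

  ∈ᵇ-∁ : ∀ X (x : Fin n) → x ∈ᵇ ∁ X ≡ not (x ∈ᵇ X)
  ∈ᵇ-∁ X x = VecP.lookup-map x not X

  ∈ᵇ-∪ : ∀ X Y (x : Fin n) → x ∈ᵇ (X ∪ Y) ≡ (x ∈ᵇ X) ∨ (x ∈ᵇ Y)
  ∈ᵇ-∪ X Y x = VecP.lookup-zipWith _∨_ x X Y

  ∈ᵇ-∩ : ∀ X Y (x : Fin n) → x ∈ᵇ (X ∩ Y) ≡ (x ∈ᵇ X) ∧ (x ∈ᵇ Y)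
  ∈ᵇ-∩ X Y x = VecP.lookup-zipWith _∧_ x X Y

  tilde-∁-uncross : ∀ f (X Y : Subset n) →
    tilde f (∁ X) + tilde f (∁ Y) ≤ tilde f (∁ (X ∪ Y)) + tilde f (∁ (X ∩ Y))
  tilde-∁-uncross f X Y = tilde₂-≤ f (∁ X) f (∁ Y) f (∁ (X ∪ Y)) f (∁ (X ∩ Y)) pointwise
    where
    pointwise : ∀ x → restrict f (∁ X) x + restrict f (∁ Y) x ≤
                      restrict f (∁ (X ∪ Y)) x + restrict f (∁ (X ∩ Y)) x
    pointwise x rewrite ∈ᵇ-∁ X x | ∈ᵇ-∁ Y x | ∈ᵇ-∁ (X ∪ Y) x | ∈ᵇ-∁ (X ∩ Y) x
                      | ∈ᵇ-∪ X Y x | ∈ᵇ-∩ X Y x with x ∈ᵇ X | x ∈ᵇ Y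
    ... | true | true = ℕP.≤-refl
    ... | true | false = ℕP.≤-refl
    ... | false | true = ℕP.≤-reflexive (ℕP.+-comm (f x) 0)
    ... | false | false = ℕP.≤-refl

  tilde-uncross : ∀ g (X Y : Subset n) →
    tilde g (X ∪ Y) + tilde g (X ∩ Y) ≤ tilde g X + tilde g Y
  tilde-uncross g X Y = tilde₂-≤ g (X ∪ Y) g (X ∩ Y) g X g Y pointwise
    where
    pointwise : ∀ x → restrict g (X ∪ Y) x + restrict g (X ∩ Y) x ≤ restrict g X x + restrict g Y x
    pointwise x rewrite ∈ᵇ-∪ X Y x | ∈ᵇ-∩ X Y x with x ∈ᵇ X | x ∈ᵇ Y
    ... | true | true = ℕP.≤-refl
    ... | true | false = ℕP.≤-refl
    ... | false | true = ℕP.≤-reflexive (ℕP.+-comm (g x) 0)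
    ... | false | false = ℕP.≤-refl

  tilde-mixed-uncross : ∀ {f g} → (∀ v → f v ≤ g v) → ∀ (X Y : Subset n) →
    tilde f (∁ X) + tilde g (X ∩ Y) ≤ tilde f (∁ (X ∪ Y)) + tilde g Y
  tilde-mixed-uncross {f} {g} f≤g X Y = tilde₂-≤ f (∁ X) g (X ∩ Y) f (∁ (X ∪ Y)) g Y pointwise
    where
    pointwise : ∀ x → restrict f (∁ X) x + restrict g (X ∩ Y) x ≤
                      restrict f (∁ (X ∪ Y)) x + restrict g Y x
    pointwise x rewrite ∈ᵇ-∁ X x | ∈ᵇ-∁ (X ∪ Y) x | ∈ᵇ-∪ X Y x | ∈ᵇ-∩ X Y x
      with x ∈ᵇ X | x ∈ᵇ Y
    ... | true | true = ℕP.≤-refl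
    ... | true | false = ℕP.≤-refl
    ... | false | true = ℕP.≤-trans (ℕP.≤-reflexive (ℕP.+-identityʳ (f x))) (f≤g x)
    ... | false | false = ℕP.≤-refl

≤-by-difference : ∀ a b c d {x y : ℤ.ℤ} → a + b ≤ c + d →
  y ℤ.- x ≡ (+ c ℤ.+ + d) ℤ.- (+ a ℤ.+ + b) → x ℤ.≤ y
≤-by-difference a b c d ab≤cd y-x≡ =
  ℤP.0≤i-j⇒j≤i (subst (ℤ.0ℤ ℤ.≤_) (sym y-x≡)
    (ℤP.i≤j⇒0≤j-i (subst₂ ℤ._≤_ (ℤP.pos-+ a b) (ℤP.pos-+ c d) (ℤ.+≤+ ab≤cd))))

data Kind : Set where
  f-bound g-bound : Kind

module Bounds {n : ℕ} (k : ℕ) (f g : Fin n → ℕ) where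

  bound : Kind → List (Subset n) → ℤ.ℤ
  bound f-bound = rhs1 k f
  bound g-bound = rhs2 k g

  -- the part of a bound that depends on ⋃P only
  weight : Kind → Subset n → ℤ.ℤ
  weight f-bound U = + tilde f (∁ U) ℤ.- + k
  weight g-bound U = ℤ.- + tilde g U

  bound-split : ∀ j P → bound j P ≡ + k ℤ.* + length P ℤ.+ weight j (⋃ P)
  bound-split f-bound P = identity (+ k) (+ length P) (+ tilde f (∁ (⋃ P)))
    where
    identity : ∀ K L T → K ℤ.* (L ℤ.- + 1) ℤ.+ T ≡ K ℤ.* L ℤ.+ (T ℤ.- K)
    identity = solve-∀
  bound-split g-bound P = refl

  weight-uncross : (∀ v → f v ≤ g v) → ∀ j₁ j₂ (X Y : Subset n) →
    Σ Kind λ j → Σ Kind λ j′ → weight j₁ X ℤ.+ weight j₂ Y ℤ.≤ weight j (X ∪ Y) ℤ.+ weight j′ (X ∩ Y)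
  weight-uncross f≤g f-bound f-bound X Y = f-bound , f-bound ,
    ≤-by-difference Fˣ Fʸ Fᵘ Fⁱ (tilde-∁-uncross f X Y) (identity (+ Fˣ) (+ Fʸ) (+ Fᵘ) (+ Fⁱ) (+ k))
    where
    Fˣ = tilde f (∁ X) ; Fʸ = tilde f (∁ Y) ; Fᵘ = tilde f (∁ (X ∪ Y)) ; Fⁱ = tilde f (∁ (X ∩ Y))
    identity : ∀ A B C D K → ((C ℤ.- K) ℤ.+ (D ℤ.- K)) ℤ.- ((A ℤ.- K) ℤ.+ (B ℤ.- K)) ≡ (C ℤ.+ D) ℤ.- (A ℤ.+ B)
    identity = solve-∀
  weight-uncross f≤g g-bound g-bound X Y = g-bound , g-bound ,
    ≤-by-difference Gᵘ Gⁱ Gˣ Gʸ (tilde-uncross g X Y) (identity (+ Gᵘ) (+ Gⁱ) (+ Gˣ) (+ Gʸ))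
    where
    Gˣ = tilde g X ; Gʸ = tilde g Y ; Gᵘ = tilde g (X ∪ Y) ; Gⁱ = tilde g (X ∩ Y)
    identity : ∀ A B C D → (ℤ.- A ℤ.+ ℤ.- B) ℤ.- (ℤ.- C ℤ.+ ℤ.- D) ≡ (C ℤ.+ D) ℤ.- (A ℤ.+ B)
    identity = solve-∀
  weight-uncross f≤g f-bound g-bound X Y = f-bound , g-bound ,
    ≤-by-difference Fˣ Gⁱ Fᵘ Gʸ (tilde-mixed-uncross f≤g X Y) (identity (+ Fˣ) (+ Gⁱ) (+ Fᵘ) (+ Gʸ) (+ k))
    where
    Fˣ = tilde f (∁ X) ; Fᵘ = tilde f (∁ (X ∪ Y)) ; Gʸ = tilde g Y ; Gⁱ = tilde g (X ∩ Y)
    identity : ∀ A B C D K → ((C ℤ.- K) ℤ.+ ℤ.- B) ℤ.- ((A ℤ.- K) ℤ.+ ℤ.- D) ≡ (C ℤ.+ D) ℤ.- (A ℤ.+ B)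
    identity = solve-∀
  weight-uncross f≤g g-bound f-bound X Y = f-bound , g-bound ,
    ≤-by-difference Fʸ Gⁱ Fᵘ Gˣ mixed (identity (+ Fʸ) (+ Gⁱ) (+ Fᵘ) (+ Gˣ) (+ k))
    where
    Fʸ = tilde f (∁ Y) ; Fᵘ = tilde f (∁ (X ∪ Y)) ; Gˣ = tilde g X ; Gⁱ = tilde g (X ∩ Y)
    mixed : Fʸ + Gⁱ ≤ Fᵘ + Gˣ
    mixed = subst₂ (λ U I → Fʸ + tilde g I ≤ tilde f (∁ U) + Gˣ)
              (∪-comm Y X) (∩-comm Y X) (tilde-mixed-uncross f≤g Y X)
    identity : ∀ A B C D K → ((C ℤ.- K) ℤ.+ ℤ.- B) ℤ.- (ℤ.- D ℤ.+ (A ℤ.- K)) ≡ (C ℤ.+ D) ℤ.- (A ℤ.+ B)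
    identity = solve-∀

  bound-uncross : (∀ v → f v ≤ g v) → ∀ {F₁ F₂ P Q} → Uncrossing F₁ F₂ P Q → ∀ j₁ j₂ →
    Σ Kind λ j → Σ Kind λ j′ → bound j₁ F₁ ℤ.+ bound j₂ F₂ ℤ.≤ bound j P ℤ.+ bound j′ Q
  bound-uncross f≤g {F₁} {F₂} {P} {Q} U j₁ j₂ =
    let (j , j′ , weights≤) = weight-uncross f≤g j₁ j₂ (⋃ F₁) (⋃ F₂) in j , j′ , (begin
      bound j₁ F₁ ℤ.+ bound j₂ F₂
        ≡⟨ cong₂ ℤ._+_ (bound-split j₁ F₁) (bound-split j₂ F₂) ⟩
      (K* F₁ ℤ.+ weight j₁ (⋃ F₁)) ℤ.+ (K* F₂ ℤ.+ weight j₂ (⋃ F₂))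
        ≡⟨ +-interchangeℤ (K* F₁) _ _ _ ⟩
      (K* F₁ ℤ.+ K* F₂) ℤ.+ (weight j₁ (⋃ F₁) ℤ.+ weight j₂ (⋃ F₂))
        ≤⟨ ℤP.+-mono-≤ (ℤP.≤-reflexive sizes) weights≤ ⟩
      (K* P ℤ.+ K* Q) ℤ.+ (weight j (⋃ F₁ ∪ ⋃ F₂) ℤ.+ weight j′ (⋃ F₁ ∩ ⋃ F₂))
        ≡⟨ cong₂ (λ A B → (K* P ℤ.+ K* Q) ℤ.+ (weight j A ℤ.+ weight j′ B)) (sym ⋃P≡) (sym ⋃Q≡) ⟩
      (K* P ℤ.+ K* Q) ℤ.+ (weight j (⋃ P) ℤ.+ weight j′ (⋃ Q))
        ≡⟨ +-interchangeℤ (K* P) _ _ _ ⟩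
      (K* P ℤ.+ weight j (⋃ P)) ℤ.+ (K* Q ℤ.+ weight j′ (⋃ Q))
        ≡⟨ sym (cong₂ ℤ._+_ (bound-split j P) (bound-split j′ Q)) ⟩
      bound j P ℤ.+ bound j′ Q ∎)
    where
    open Uncrossing U
    open ℤP.≤-Reasoning
    K* : List (Subset n) → ℤ.ℤ
    K* R = + k ℤ.* + length R
    K*-+ : ∀ R S → K* R ℤ.+ K* S ≡ + (k * (length R + length S))
    K*-+ R S = begin-equality
      + k ℤ.* + length R ℤ.+ + k ℤ.* + length S  ≡⟨ ℤP.*-distribˡ-+ (+ k) (+ length R) _ ⟨
      + k ℤ.* (+ length R ℤ.+ + length S)       ≡⟨ cong (+ k ℤ.*_) (ℤP.pos-+ (length R) _) ⟨
      + k ℤ.* + (length R + length S)           ≡⟨ ℤP.pos-* k _ ⟨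
      + (k * (length R + length S))             ∎
    sizes : K* F₁ ℤ.+ K* F₂ ≡ K* P ℤ.+ K* Q
    sizes = trans (K*-+ F₁ F₂) (trans (cong (λ m → + (k * m)) (sym size)) (sym (K*-+ P Q)))

lemma2p5 : ∀ {n} (F : MixedGraph n) (k : ℕ) (f g : Fin n → ℕ) →
    1 ≤ k →
    (∀ v → f v ≤ g v) →
    (∀ (P : List (Subset n)) → IsFamily P →
      (rhs1 k f P ℤ.≤ + lhs F P) × (rhs2 k g P ℤ.≤ + lhs F P)) →
    ∀ (F₁ F₂ : List (Subset n)) →
    (InE1 F k f F₁ ⊎ InE2 F k g F₁) →
    (InE1 F k f F₂ ⊎ InE2 F k g F₂) →
    ¬ (Σ (Fin n × Fin n) λ e → Σ (Fin n) λ u → Σ (Fin n) λ v →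
        (e ∈ₗ E F) × ((e ≡ (u , v)) ⊎ (e ≡ (v , u))) ×
        (u ∈ ⋃ F₁) × ¬ (u ∈ ⋃ F₂) × (v ∈ ⋃ F₂) × ¬ (v ∈ ⋃ F₁))
lemma2p5 F k f g _ f≤g bounds F₁ F₂ tight₁ tight₂
  (e , u , v , e∈E , e≡uv , u∈⋃F₁ , u∉⋃F₂ , v∈⋃F₂ , v∉⋃F₁) =
  let (j₁ , fam₁ , lhs≡₁) = tight tight₁
      (j₂ , fam₂ , lhs≡₂) = tight tight₂
      (P , Q , U) = uncross fam₁ fam₂
      (j , j′ , bounds≤) = bound-uncross f≤g U j₁ j₂
      open Uncrossing U
  in ℤP.<-irrefl refl (begin-strict
    + lhs F F₁ ℤ.+ + lhs F F₂    ≡⟨ cong₂ ℤ._+_ lhs≡₁ lhs≡₂ ⟩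
    bound j₁ F₁ ℤ.+ bound j₂ F₂  ≤⟨ bounds≤ ⟩
    bound j P ℤ.+ bound j′ Q     ≤⟨ ℤP.+-mono-≤ (valid j P-family) (valid j′ Q-family) ⟩
    + lhs F P ℤ.+ + lhs F Q      ≡⟨ ℤP.pos-+ (lhs F P) _ ⟨
    + (lhs F P + lhs F Q)        <⟨ ℤ.+<+ (lhs-uncross-< U F e∈E e≡uv u∈⋃F₁ u∉⋃F₂ v∈⋃F₂ v∉⋃F₁) ⟩
    + (lhs F F₁ + lhs F F₂)      ≡⟨ ℤP.pos-+ (lhs F F₁) _ ⟩
    + lhs F F₁ ℤ.+ + lhs F F₂    ∎)
  where
  open Bounds k f g
  open ℤP.≤-Reasoning

  tight : ∀ {R} → InE1 F k f R ⊎ InE2 F k g R → Σ Kind λ j → IsFamily R × + lhs F R ≡ bound j R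
  tight (inj₁ (fam , lhs≡)) = f-bound , fam , lhs≡
  tight (inj₂ (fam , lhs≡)) = g-bound , fam , lhs≡

  valid : ∀ j {R} → IsFamily R → bound j R ℤ.≤ + lhs F R
  valid f-bound {R} fam = proj₁ (bounds R fam)
  valid g-bound {R} fam = proj₂ (bounds R fam)
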